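{- Let $\mathfrak{X}=(X,\{R_i\}_{i=0}^d)$ be a symmetric association scheme of class $d$ with adjacency matrices $A_0,A_1,\ldots,A_d$ and primitive idempotents $E_0,\ldots,E_d$ of its Bose--Mesner algebra $\mathfrak{A}$, and let $\theta_i=P_1(i)$ denote the eigenvalue of $A_1$ on $E_i$ (i.e. $A_1=\sum_{i=0}^d\theta_iE_i$). Suppose that $\theta_0$ is distinct from each of $\theta_1,\ldots,\theta_d$. Say that $A_j$ appears in an element $M\in\mathfrak{A}$ if there is a nonzero complex number $\alpha$ with $M\circ A_j=\alpha A_j$ (where $\circ$ is the entrywise (Hadamard) product). For $h\ge 0$, let $N^{\ast}_h$ be the set of indices $j$ such that $A_j$ appears in $A_1^h$ but does not appear in $A_1^{l}$ for any $0\le l\le h-1$. Then the following are equivalent: (1) $\mathfrak{X}$ is a $P$-polynomial scheme with respect to $A_1$, i.e. there is an ordering $A_0,A_1,A_{\xi_2},\ldots,A_{\xi_d}$ of the adjacency matrices and polynomials $v_i$ of degree $i$ with $P_{\xi_i}(j)=v_i(P_1(j))$ for all $i,j$ (equivalently $A_{\xi_i}=v_i(A_1)$). (2) $\bigcup_{h=0}^{d-1} N^{\ast}_h \neq \{0,1,\ldots,d\}$.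
   Context: Here $P=(P_i(j))$ is the first eigenmatrix, defined by $A_i=\sum_{j=0}^d P_i(j)E_j$. Under the hypothesis that $\theta_0$ is distinct from $\theta_1,\ldots,\theta_d$, one has $J=|X|\prod_{j=1}^d\frac{A_1-\theta_jI}{\theta_0-\theta_j}$, so $\{0,1,\ldots,d\}$ is the disjoint union $\bigcup_{h=0}^d N^{\ast}_h$; also $N^{\ast}_0=\{0\}$ and $N^{\ast}_1=\{1\}$. -}

module Defs where

open import Level using (Level; _⊔_) renaming (suc to lsuc)
open import Data.Nat using (ℕ; zero; suc; _<_) renaming (_+_ to _+ℕ_)
open import Data.Fin using (Fin; zero; suc; toℕ; _≟_)
open import Data.Vec using (Vec; []; _∷_; last)
open import Data.Bool using (Bool; true; false; if_then_else_)
open import Data.Product using (Σ; ∃; ∃₂; _×_; _,_)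
open import Relation.Nullary using (¬_; yes; no; does)
open import Relation.Binary.PropositionalEquality using (_≡_)
open import Function.Definitions using (Bijective)
open import Algebra.Bundles using (CommutativeRing)

count : ∀ {n} → (Fin n → Bool) → ℕ
count {zero}  f = 0
count {suc n} f = (if f zero then 1 else 0) +ℕ count (λ z → f (suc z))

_==_ : ∀ {m} → Fin m → Fin m → Bool
a == b = does (a ≟ b)

record SymAssocScheme (n d : ℕ) : Set where
  field
    rel          : Fin n → Fin n → Fin (suc d)
    rel-diag     : ∀ x → rel x x ≡ zero
    rel-zero     : ∀ x y → rel x y ≡ zero → x ≡ y
    rel-nonempty : ∀ i → ∃₂ λ x y → rel x y ≡ i
    rel-symm     : ∀ x y → rel x y ≡ rel y x
    p            : Fin (suc d) → Fin (suc d) → Fin (suc d) → ℕ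
    intersection : ∀ i j x y →
      count (λ z → (rel x z == i) Data.Bool.∧ (rel z y == j)) ≡ p i j (rel x y)

-- A field of characteristic zero (playing the role of ℂ)

module _ {c ℓ : Level} (R : CommutativeRing c ℓ) where
  open CommutativeRing R using (Carrier; 0#; 1#; _+_)
  ℕ→ : ℕ → Carrier
  ℕ→ zero    = 0#
  ℕ→ (suc m) = 1# + ℕ→ m

record CharZeroField (c ℓ : Level) : Set (lsuc (c ⊔ ℓ)) where
  field
    cring : CommutativeRing c ℓ
  open CommutativeRing cring public
    using (Carrier; _≈_; 0#; 1#; _+_; _*_)
  field
    inverse  : ∀ x → ¬ (x ≈ 0#) → ∃ λ y → x * y ≈ 1#
    charZero : ∀ m → ¬ (ℕ→ cring (suc m) ≈ 0#)

module Matrices {c ℓ : Level} (K : CharZeroField c ℓ) where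
  open CharZeroField K

  Mat : ℕ → Set c
  Mat n = Fin n → Fin n → Carrier

  Σ[_] : ∀ m → (Fin m → Carrier) → Carrier
  Σ[ zero  ] f = 0#
  Σ[ suc m ] f = f zero + Σ[ m ] (λ i → f (suc i))

  _≈ₘ_ : ∀ {n} → Mat n → Mat n → Set ℓ
  M ≈ₘ N = ∀ x y → M x y ≈ N x y

  _·_ : ∀ {n} → Mat n → Mat n → Mat n
  _·_ {n} M N x y = Σ[ n ] (λ z → M x z * N z y)

  _∘ₕ_ : ∀ {n} → Mat n → Mat n → Mat n
  (M ∘ₕ N) x y = M x y * N x y

  _•_ : ∀ {n} → Carrier → Mat n → Mat n
  (α • M) x y = α * M x y

  _⊕_ : ∀ {n} → Mat n → Mat n → Mat n
  (M ⊕ N) x y = M x y + N x y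

  𝟎 : ∀ {n} → Mat n
  𝟎 x y = 0#

  𝐈 : ∀ {n} → Mat n
  𝐈 x y = if x == y then 1# else 0#

  Σₘ[_] : ∀ {n} m → (Fin m → Mat n) → Mat n
  Σₘ[ m ] F x y = Σ[ m ] (λ i → F i x y)

  _^_ : ∀ {n} → Mat n → ℕ → Mat n
  M ^ zero  = 𝐈
  M ^ suc h = M · (M ^ h)

  -- polynomial with coefficient vector (constant term first), Horner evaluation
  eval : ∀ {m} → Vec Carrier m → Carrier → Carrier
  eval []       t = 0#
  eval (a ∷ as) t = a + t * eval as t

module Scheme {c ℓ : Level} (K : CharZeroField c ℓ)
              {n d : ℕ} (S : SymAssocScheme n d) where
  open CharZeroField K
  open Matrices K
  open SymAssocScheme S

  A : Fin (suc d) → Mat n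
  A i x y = if rel x y == i then 1# else 0#

  -- The primitive idempotents E_0,…,E_d of the Bose–Mesner algebra
  -- (E_0 = |X|⁻¹ J) and the first eigenmatrix P with A_i = Σ_j P_i(j) E_j.
  record Eigen : Set (c ⊔ ℓ) where
    field
      E        : Fin (suc d) → Mat n
      P        : Fin (suc d) → Fin (suc d) → Carrier
      E-in-BM  : ∀ j → ∃ λ (γ : Fin (suc d) → Carrier) →
                   E j ≈ₘ Σₘ[ suc d ] (λ i → γ i • A i)
      E-orth   : ∀ i j → (E i · E j) ≈ₘ (if i == j then E i else 𝟎)
      E-sum    : Σₘ[ suc d ] E ≈ₘ 𝐈
      E-nonzero : ∀ i → ¬ (E i ≈ₘ 𝟎)
      E₀-J     : ∀ x y → ℕ→ cring n * E zero x y ≈ 1#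
      A-P      : ∀ i → A i ≈ₘ Σₘ[ suc d ] (λ j → P i j • E j)

  Appears : Mat n → Fin (suc d) → Set (c ⊔ ℓ)
  Appears M j = ∃ λ α → ¬ (α ≈ 0#) × ((M ∘ₕ A j) ≈ₘ (α • A j))

-- The case of class d ≥ 1, where A_1 exists

module SchemeA1 {c ℓ : Level} (K : CharZeroField c ℓ)
                {n d : ℕ} (S : SymAssocScheme n (suc d)) where
  open CharZeroField K
  open Matrices K
  open Scheme K S public

  one : Fin (suc (suc d))
  one = suc zero

  InNstar : ℕ → Fin (suc (suc d)) → Set (c ⊔ ℓ)
  InNstar h j = Appears (A one ^ h) j × (∀ l → l < h → ¬ Appears (A one ^ l) j)

  -- condition (2):  ⋃_{h=0}^{D-1} N*_h ≠ {0,…,D}   (here D = suc d)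
  Cond2 : Set (c ⊔ ℓ)
  Cond2 = ¬ (∀ j → ∃ λ h → h < suc d × InNstar h j)

  PPolynomial : Eigen → Set (c ⊔ ℓ)
  PPolynomial Ei =
    ∃ λ (ξ : Fin (suc (suc d)) → Fin (suc (suc d))) →
      Bijective _≡_ _≡_ ξ × ξ zero ≡ zero × ξ one ≡ one ×
      ∃ λ (v : (i : Fin (suc (suc d))) → Vec Carrier (suc (toℕ i))) →
        (∀ i → ¬ (last (v i) ≈ 0#)) ×
        (∀ i j → P (ξ i) j ≈ eval (v i) (P one j))
    where open Eigen Ei

-- Write D for the class and θ_j = P_1(j).  Since A₁ = Σ_j θ_j E_j, the power A₁^h is Σ_j θ_j^h E_j
-- and, in the basis of adjacency matrices, Σ_r c_h(r) A_r, where c_h(r) is the number of walks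
-- of length h between two vertices in relation r; so A_r appears in A₁^h iff such a walk exists
-- (characteristic 0), and θ_j^h = Σ_r c_h(r) P_r(j).
--
-- (1) ⇒ (2): for h < D, θ^h is a combination of v_0, …, v_h, so A₁^h is a combination of
-- A_{ξ_0}, …, A_{ξ_h} and A_{ξ_D} appears in no A₁^h with h < D.
--
-- (2) ⇒ (1): as θ_0 is simple, ∏_{j ≥ 1} (A₁ − θ_j I) is a nonzero multiple of E_0 = |X|⁻¹ J, so
-- any two vertices are joined by a walk of length at most D.  A relation not met before step D
-- therefore yields a geodesic of length D; the relations η_k between its end and its vertex at
-- distance k are distinct, hence exhaust all relations, η_k first appears in A₁^k, and solving
-- θ^h = c_h(η_h) P_{η_h} + Σ_{k<h} c_h(η_k) P_{η_k} shows by induction that P_{η_h} is a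
-- polynomial of degree h in θ.

module Submission where

open import Defs
open import Level using (Level; _⊔_)
open import Algebra.Bundles using (CommutativeRing; CommutativeSemiring)
open import Data.Bool using (true; false; if_then_else_)
open import Data.Fin as Fin using (Fin; zero; suc; toℕ; fromℕ<; punchIn; punchOut; _≟_)
open import Data.Fin.Induction using (<-wellFounded)
open import Data.Fin.Properties
  using (any?; ¬∀⟶∃¬; injective⇒≤; punchOut-injective; punchInᵢ≢i;
         toℕ-fromℕ; toℕ-fromℕ<; toℕ-injective; toℕ≤pred[n])
open import Data.Nat as ℕ using (ℕ; zero; suc; _≤_; _<_; z≤n; s≤s; _∸_)
import Data.Nat.Properties as ℕ
open import Data.Product using (∃; ∃₂; _×_; _,_; proj₁; proj₂)
open import Data.Sum using (inj₁; inj₂)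
open import Data.Vec using (Vec; []; _∷_; _∷ʳ_; last; map; zipWith; replicate; padRight; initLast)
open import Data.Vec.Properties using (last-∷ʳ)
open import Data.Vec.Functional using (foldr)
open import Function using (_∘_)
open import Function.Bundles using (_⇔_; mk⇔; Equivalence)
open import Function.Consequences.Propositional using (strictlySurjective⇒surjective)
open import Function.Definitions using (Injective; Surjective)
import Function.Properties.Equivalence as ⇔
open import Induction.WellFounded using (module All)
open import Relation.Binary.PropositionalEquality as ≡ using (_≡_; _≢_)
open import Relation.Nullary using (¬_; Dec; yes; no; contradiction; ¬?; _×-dec_)
open import Relation.Nullary.Decidable as Dec using (dec-true; dec-false; map′)

injective⇒surjective : ∀ {m} {f : Fin m → Fin m} → Injective _≡_ _≡_ f → Surjective _≡_ _≡_ f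
injective⇒surjective {suc m} {f} f-inj = strictlySurjective⇒surjective hit
  where
  hit : ∀ y → ∃ λ x → f x ≡ y
  hit y with any? (λ x → f x ≟ y)
  ... | yes found = found
  ... | no  missed = contradiction (injective⇒≤ f∖y-injective) ℕ.1+n≰n
    where
    y≢f : ∀ x → y ≢ f x
    y≢f x y≡fx = missed (x , ≡.sym y≡fx)
    f∖y : Fin (suc m) → Fin m
    f∖y x = punchOut (y≢f x)
    f∖y-injective : Injective _≡_ _≡_ f∖y
    f∖y-injective eq = f-inj (punchOut-injective (y≢f _) (y≢f _) eq)

open import Algebra.Properties.CommutativeMonoid.Sum ℕ.+-0-commutativeMonoid
  using () renaming (sum to sumℕ)

sumℕ≡0⇒≡0 : ∀ {m} (f : Fin m → ℕ) → sumℕ f ≡ 0 → ∀ i → f i ≡ 0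
sumℕ≡0⇒≡0 f sum≡0 zero    = ℕ.m+n≡0⇒m≡0 (f zero) sum≡0
sumℕ≡0⇒≡0 f sum≡0 (suc i) = sumℕ≡0⇒≡0 (f ∘ suc) (ℕ.m+n≡0⇒n≡0 (f zero) sum≡0) i

≡0⇒sumℕ≡0 : ∀ {m} (f : Fin m → ℕ) → (∀ i → f i ≡ 0) → sumℕ f ≡ 0
≡0⇒sumℕ≡0 {zero}  f f≡0 = ≡.refl
≡0⇒sumℕ≡0 {suc m} f f≡0 = ≡.cong₂ ℕ._+_ (f≡0 zero) (≡0⇒sumℕ≡0 (f ∘ suc) (f≡0 ∘ suc))

module CommutativeSemiringIdentities {c ℓ : Level} (R : CommutativeSemiring c ℓ) where
  open CommutativeSemiring R
  open import Algebra.Solver.Ring.NaturalCoefficients.Default R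

  horner-snoc : ∀ a t e l p → a + t * (e + l * p) ≈ (a + t * e) + l * (t * p)
  horner-snoc = solve 5 (λ a t e l p → a :+ t :* (e :+ l :* p) := (a :+ t :* e) :+ l :* (t :* p)) refl

  horner-+ : ∀ a b t e f → (a + b) + t * (e + f) ≈ (a + t * e) + (b + t * f)
  horner-+ = solve 5 (λ a b t e f → (a :+ b) :+ t :* (e :+ f) := (a :+ t :* e) :+ (b :+ t :* f)) refl

  horner-* : ∀ s a t e → s * a + t * (s * e) ≈ s * (a + t * e)
  horner-* = solve 4 (λ s a t e → s :* a :+ t :* (s :* e) := s :* (a :+ t :* e)) refl

  collect-leading : ∀ v u c f g → v * g + u * (c * f + g) ≈ (u * c) * f + (v + u) * g
  collect-leading = solve 5 (λ v u c f g → v :* g :+ u :* (c :* f :+ g) := (u :* c) :* f :+ (v :+ u) :* g) refl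

  collect-elimination : ∀ w v r s k p → (w + r * v) + s * (v + k * p) ≈ (w + (r + s) * v) + (s * k) * p
  collect-elimination = solve 6 (λ w v r s k p → (w :+ r :* v) :+ s :* (v :+ k :* p) := (w :+ (r :+ s) :* v) :+ (s :* k) :* p) refl

module FieldProperties {c ℓ : Level} (K : CharZeroField c ℓ) where
  open CharZeroField K public using (cring; inverse; charZero)
  open CommutativeRing cring public hiding (zero)
  open import Algebra.Properties.Ring ring public using (x∙y⁻¹≈ε⇒x≈y)
  open import Algebra.Properties.CommutativeSemigroup *-commutativeSemigroup public
    using (x∙yz≈y∙xz; x∙yz≈yx∙z)
  open CommutativeSemiringIdentities commutativeSemiring public
  open import Algebra.Properties.Semiring.Exp semiring public using (_^_)
  open import Relation.Binary.Reasoning.Setoid setoid public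
  open Matrices K public using (Σ[_]; eval)
  open import Algebra.Properties.Semiring.Sum semiring
    using (sum; sum-cong-≋; sum-cong-≗; ∑-distrib-+; ∑-comm; *-distribˡ-sum; sum-remove; sum-replicate-zero)

  1≉0 : 1# ≉ 0#
  1≉0 1≈0 = charZero 0 (trans (+-identityʳ 1#) 1≈0)

  inverse-cancelˡ : ∀ {x u} y → x * u ≈ 1# → u * (x * y) ≈ y
  inverse-cancelˡ {x} {u} y xu≈1 = begin
    u * (x * y)   ≈⟨ x∙yz≈y∙xz u x y ⟩
    x * (u * y)   ≈⟨ *-assoc x u y ⟨
    (x * u) * y   ≈⟨ *-congʳ xu≈1 ⟩
    1# * y        ≈⟨ *-identityˡ y ⟩
    y             ∎

  *-cancelˡ-≉0 : ∀ {x y z} → x ≉ 0# → x * y ≈ x * z → y ≈ z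
  *-cancelˡ-≉0 {x} {y} {z} x≉0 xy≈xz with inverse x x≉0
  ... | u , xu≈1 = begin
    y             ≈⟨ inverse-cancelˡ y xu≈1 ⟨
    u * (x * y)   ≈⟨ *-congˡ xy≈xz ⟩
    u * (x * z)   ≈⟨ inverse-cancelˡ z xu≈1 ⟩
    z             ∎

  *-≈0⇒≈0 : ∀ {x y} → x ≉ 0# → x * y ≈ 0# → y ≈ 0#
  *-≈0⇒≈0 {x} x≉0 xy≈0 = *-cancelˡ-≉0 x≉0 (trans xy≈0 (sym (zeroʳ x)))

  *-cancelʳ-≉0 : ∀ {x y z} → x ≉ 0# → y * x ≈ z * x → y ≈ z
  *-cancelʳ-≉0 {x} {y} {z} x≉0 yx≈zx =
    *-cancelˡ-≉0 x≉0 (trans (*-comm x y) (trans yx≈zx (*-comm z x)))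

  *-≉0 : ∀ {x y} → x ≉ 0# → y ≉ 0# → x * y ≉ 0#
  *-≉0 x≉0 y≉0 xy≈0 = y≉0 (*-≈0⇒≈0 x≉0 xy≈0)

  ι : ℕ → Carrier
  ι = ℕ→ cring

  ι-+ : ∀ a b → ι (a ℕ.+ b) ≈ ι a + ι b
  ι-+ zero    b = sym (+-identityˡ (ι b))
  ι-+ (suc a) b = trans (+-congˡ (ι-+ a b)) (sym (+-assoc 1# (ι a) (ι b)))

  ι≉0 : ∀ {a} → a ≢ 0 → ι a ≉ 0#
  ι≉0 {zero}  a≢0 = contradiction ≡.refl a≢0
  ι≉0 {suc a} _   = charZero a

  ι-sum : ∀ {m} (f : Fin m → ℕ) → ι (sumℕ f) ≈ Σ[ m ] (ι ∘ f)
  ι-sum {zero}  f = refl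
  ι-sum {suc m} f = trans (ι-+ (f zero) _) (+-congˡ (ι-sum (f ∘ suc)))

  Σ≡sum : ∀ {m} (f : Fin m → Carrier) → Σ[ m ] f ≡ sum f
  Σ≡sum {zero}  f = ≡.refl
  Σ≡sum {suc m} f = ≡.cong (f zero +_) (Σ≡sum (f ∘ suc))

  Σ-cong : ∀ {m} {f g : Fin m → Carrier} → (∀ i → f i ≈ g i) → Σ[ m ] f ≈ Σ[ m ] g
  Σ-cong {f = f} {g} f≈g = begin
    Σ[ _ ] f   ≡⟨ Σ≡sum f ⟩
    sum f      ≈⟨ sum-cong-≋ f≈g ⟩
    sum g      ≡⟨ Σ≡sum g ⟨
    Σ[ _ ] g   ∎

  Σ-≈0 : ∀ {m} {f : Fin m → Carrier} → (∀ i → f i ≈ 0#) → Σ[ m ] f ≈ 0#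
  Σ-≈0 {m} {f} f≈0 = begin
    Σ[ m ] f             ≈⟨ Σ-cong f≈0 ⟩
    Σ[ m ] (λ _ → 0#)    ≡⟨ Σ≡sum {m} (λ _ → 0#) ⟩
    sum {m} (λ _ → 0#)   ≈⟨ sum-replicate-zero m ⟩
    0#                   ∎

  Σ-distrib-+ : ∀ {m} (f g : Fin m → Carrier) → Σ[ m ] (λ i → f i + g i) ≈ Σ[ m ] f + Σ[ m ] g
  Σ-distrib-+ f g = begin
    Σ[ _ ] (λ i → f i + g i)   ≡⟨ Σ≡sum (λ i → f i + g i) ⟩
    sum (λ i → f i + g i)      ≈⟨ ∑-distrib-+ f g ⟩
    sum f + sum g              ≡⟨ ≡.cong₂ _+_ (Σ≡sum f) (Σ≡sum g) ⟨
    Σ[ _ ] f + Σ[ _ ] g        ∎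

  *-distribˡ-Σ : ∀ {m} x (f : Fin m → Carrier) → x * Σ[ m ] f ≈ Σ[ m ] (λ i → x * f i)
  *-distribˡ-Σ x f = begin
    x * Σ[ _ ] f               ≡⟨ ≡.cong (x *_) (Σ≡sum f) ⟩
    x * sum f                  ≈⟨ *-distribˡ-sum x f ⟩
    sum (λ i → x * f i)        ≡⟨ Σ≡sum (λ i → x * f i) ⟨
    Σ[ _ ] (λ i → x * f i)     ∎

  *-distribʳ-Σ : ∀ {m} x (f : Fin m → Carrier) → Σ[ m ] f * x ≈ Σ[ m ] (λ i → f i * x)
  *-distribʳ-Σ x f = trans (*-comm _ x) (trans (*-distribˡ-Σ x f) (Σ-cong (λ i → *-comm x (f i))))

  Σ-comm : ∀ {m k} (f : Fin m → Fin k → Carrier) →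
           Σ[ m ] (λ i → Σ[ k ] (f i)) ≈ Σ[ k ] (λ j → Σ[ m ] (λ i → f i j))
  Σ-comm f = begin
    Σ[ _ ] (λ i → Σ[ _ ] (f i))                ≡⟨ Σ≡sum (λ i → Σ[ _ ] (f i)) ⟩
    sum (λ i → Σ[ _ ] (f i))                   ≡⟨ sum-cong-≗ (λ i → Σ≡sum (f i)) ⟩
    sum (λ i → sum (f i))                      ≈⟨ ∑-comm f ⟩
    sum (λ j → sum (λ i → f i j))              ≡⟨ sum-cong-≗ (λ j → Σ≡sum (λ i → f i j)) ⟨
    sum (λ j → Σ[ _ ] (λ i → f i j))           ≡⟨ Σ≡sum (λ j → Σ[ _ ] (λ i → f i j)) ⟨
    Σ[ _ ] (λ j → Σ[ _ ] (λ i → f i j))        ∎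

  Σ-remove : ∀ {m} (f : Fin (suc m) → Carrier) j → Σ[ suc m ] f ≈ f j + Σ[ m ] (f ∘ punchIn j)
  Σ-remove f j = begin
    Σ[ _ ] f                   ≡⟨ Σ≡sum f ⟩
    sum f                      ≈⟨ sum-remove f ⟩
    f j + sum (f ∘ punchIn j)  ≡⟨ ≡.cong (f j +_) (Σ≡sum (f ∘ punchIn j)) ⟨
    f j + Σ[ _ ] (f ∘ punchIn j) ∎

  Σ-single : ∀ {m} (f : Fin m → Carrier) j → (∀ i → i ≢ j → f i ≈ 0#) → Σ[ m ] f ≈ f j
  Σ-single {suc m} f j f≈0 = begin
    Σ[ suc m ] f                    ≈⟨ Σ-remove f j ⟩
    f j + Σ[ m ] (f ∘ punchIn j)    ≈⟨ +-congˡ (Σ-≈0 (λ i → f≈0 (punchIn j i) (punchInᵢ≢i j i))) ⟩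
    f j + 0#                        ≈⟨ +-identityʳ (f j) ⟩
    f j                             ∎

  ∏ : ∀ {m} → (Fin m → Carrier) → Carrier
  ∏ = foldr _*_ 1#

  ∏-≈0 : ∀ {m} (f : Fin m → Carrier) i → f i ≈ 0# → ∏ f ≈ 0#
  ∏-≈0 f zero    fi≈0 = trans (*-congʳ fi≈0) (zeroˡ _)
  ∏-≈0 f (suc i) fi≈0 = trans (*-congˡ (∏-≈0 (f ∘ suc) i fi≈0)) (zeroʳ _)

  ∏-≉0 : ∀ {m} (f : Fin m → Carrier) → (∀ i → f i ≉ 0#) → ∏ f ≉ 0#
  ∏-≉0 {zero}  f f≉0 = 1≉0
  ∏-≉0 {suc m} f f≉0 = *-≉0 (f≉0 zero) (∏-≉0 (f ∘ suc) (f≉0 ∘ suc))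

module Polynomials {c ℓ : Level} (K : CharZeroField c ℓ) where
  open FieldProperties K

  eval-∷ʳ : ∀ {m} (w : Vec Carrier m) l t → eval (w ∷ʳ l) t ≈ eval w t + l * t ^ m
  eval-∷ʳ []      l t = begin
    l + t * 0#     ≈⟨ +-congˡ (zeroʳ t) ⟩
    l + 0#         ≈⟨ +-comm l 0# ⟩
    0# + l         ≈⟨ +-congˡ (*-identityʳ l) ⟨
    0# + l * 1#    ∎
  eval-∷ʳ {suc m} (a ∷ w) l t = begin
    a + t * eval (w ∷ʳ l) t                ≈⟨ +-congˡ (*-congˡ (eval-∷ʳ w l t)) ⟩
    a + t * (eval w t + l * t ^ m)         ≈⟨ horner-snoc a t (eval w t) l (t ^ m) ⟩
    (a + t * eval w t) + l * (t * t ^ m)   ∎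

  eval-zipWith-+ : ∀ {m} (u w : Vec Carrier m) t → eval (zipWith _+_ u w) t ≈ eval u t + eval w t
  eval-zipWith-+ []      []      t = sym (+-identityʳ 0#)
  eval-zipWith-+ (a ∷ u) (b ∷ w) t =
    trans (+-congˡ (*-congˡ (eval-zipWith-+ u w t))) (horner-+ a b t (eval u t) (eval w t))

  eval-map-* : ∀ {m} s (w : Vec Carrier m) t → eval (map (s *_) w) t ≈ s * eval w t
  eval-map-* s []      t = sym (zeroʳ s)
  eval-map-* s (a ∷ w) t =
    trans (+-congˡ (*-congˡ (eval-map-* s w t))) (horner-* s a t (eval w t))

  eval-replicate-0 : ∀ m t → eval (replicate m 0#) t ≈ 0#
  eval-replicate-0 zero    t = refl
  eval-replicate-0 (suc m) t =
    trans (+-identityˡ _) (trans (*-congˡ (eval-replicate-0 m t)) (zeroʳ t))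

  eval-padRight : ∀ {m m′} (m≤m′ : m ≤ m′) (w : Vec Carrier m) t →
                  eval (padRight m≤m′ 0# w) t ≈ eval w t
  eval-padRight {m′ = m′} z≤n [] t = eval-replicate-0 m′ t
  eval-padRight (s≤s m≤m′) (a ∷ w) t = +-congˡ (*-congˡ (eval-padRight m≤m′ w t))

  module PolynomialsOn {N : ℕ} (x : Fin N → Carrier) where

    IsPoly< : ℕ → (Fin N → Carrier) → Set (c ⊔ ℓ)
    IsPoly< m f = ∃ λ (w : Vec Carrier m) → ∀ i → f i ≈ eval w (x i)

    IsPolyOfDegree : ℕ → (Fin N → Carrier) → Set (c ⊔ ℓ)
    IsPolyOfDegree m f = ∃ λ (w : Vec Carrier (suc m)) → last w ≉ 0# × (∀ i → f i ≈ eval w (x i))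

    poly<-resp : ∀ {m f g} → (∀ i → f i ≈ g i) → IsPoly< m f → IsPoly< m g
    poly<-resp f≈g (w , f≈w) = w , λ i → trans (sym (f≈g i)) (f≈w i)

    poly<-mono : ∀ {m m′ f} → m ≤ m′ → IsPoly< m f → IsPoly< m′ f
    poly<-mono m≤m′ (w , f≈w) =
      padRight m≤m′ 0# w , λ i → trans (f≈w i) (sym (eval-padRight m≤m′ w (x i)))

    poly<-zero : ∀ {m} → IsPoly< m (λ _ → 0#)
    poly<-zero = poly<-mono z≤n ([] , λ _ → refl)

    poly<-+ : ∀ {m f g} → IsPoly< m f → IsPoly< m g → IsPoly< m (λ i → f i + g i)
    poly<-+ (u , f≈u) (w , g≈w) =
      zipWith _+_ u w , λ i → trans (+-cong (f≈u i) (g≈w i)) (sym (eval-zipWith-+ u w (x i)))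

    poly<-scale : ∀ {m f} s → IsPoly< m f → IsPoly< m (λ i → s * f i)
    poly<-scale s (w , f≈w) =
      map (s *_) w , λ i → trans (*-congˡ (f≈w i)) (sym (eval-map-* s w (x i)))

    poly<-Σ : ∀ {m k} {F : Fin k → Fin N → Carrier} →
              (∀ r → IsPoly< m (F r)) → IsPoly< m (λ i → Σ[ k ] (λ r → F r i))
    poly<-Σ {k = zero}  F-poly = poly<-zero
    poly<-Σ {k = suc k} F-poly = poly<-+ (F-poly zero) (poly<-Σ (F-poly ∘ suc))

    poly<-x* : ∀ {m f} → IsPoly< m f → IsPoly< (suc m) (λ i → x i * f i)
    poly<-x* (w , f≈w) = 0# ∷ w , λ i → trans (*-congˡ (f≈w i)) (sym (+-identityˡ _))

    degree⇒poly< : ∀ {m f} → IsPolyOfDegree m f → IsPoly< (suc m) f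
    degree⇒poly< (w , _ , f≈w) = w , f≈w

    monomial : ∀ m → IsPolyOfDegree m (λ i → x i ^ m)
    monomial m = replicate m 0# ∷ʳ 1# , leading≉0 , λ i → sym (eval-xᵐ (x i))
      where
      leading≉0 : last (replicate m 0# ∷ʳ 1#) ≉ 0#
      leading≉0 = 1≉0 ∘ trans (reflexive (≡.sym (last-∷ʳ 1# (replicate m 0#))))
      eval-xᵐ : ∀ t → eval (replicate m 0# ∷ʳ 1#) t ≈ t ^ m
      eval-xᵐ t = begin
        eval (replicate m 0# ∷ʳ 1#) t             ≈⟨ eval-∷ʳ (replicate m 0#) 1# t ⟩
        eval (replicate m 0#) t + 1# * t ^ m      ≈⟨ +-cong (eval-replicate-0 m t) (*-identityˡ _) ⟩
        0# + t ^ m                                ≈⟨ +-identityˡ _ ⟩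
        t ^ m                                     ∎

    poly<-∏-linear : ∀ {k} (r : Fin k → Carrier) → IsPoly< (suc k) (λ i → ∏ (λ q → x i - r q))
    poly<-∏-linear {zero}  r = 1# ∷ [] , λ i → sym (trans (+-congˡ (zeroʳ (x i))) (+-identityʳ 1#))
    poly<-∏-linear {suc k} r =
      poly<-resp (λ i → sym (distribʳ _ (x i) (- r zero)))
        (poly<-+ (poly<-x* rest) (poly<-mono (ℕ.n≤1+n (suc k)) (poly<-scale (- r zero) rest)))
      where
      rest = poly<-∏-linear (r ∘ suc)

    poly-of-degree : ∀ {m c f g} → c ≉ 0# → IsPoly< m g →
                     (∀ i → x i ^ m ≈ c * f i + g i) → IsPolyOfDegree m f
    poly-of-degree {m} {c} {f} {g} c≉0 (w , g≈w) xᵐ≈cf+g with inverse c c≉0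
    ... | u , cu≈1 = map (- u *_) w ∷ʳ u , leading≉0 , λ i → sym (eval≈f i)
      where
      leading≉0 : last (map (- u *_) w ∷ʳ u) ≉ 0#
      leading≉0 u≈0 = 1≉0 (begin
        1#                             ≈⟨ cu≈1 ⟨
        c * u                          ≡⟨ ≡.cong (c *_) (last-∷ʳ u (map (- u *_) w)) ⟨
        c * last (map (- u *_) w ∷ʳ u) ≈⟨ *-congˡ u≈0 ⟩
        c * 0#                         ≈⟨ zeroʳ c ⟩
        0#                             ∎)
      eval≈f : ∀ i → eval (map (- u *_) w ∷ʳ u) (x i) ≈ f i
      eval≈f i = begin
        eval (map (- u *_) w ∷ʳ u) (x i)                ≈⟨ eval-∷ʳ (map (- u *_) w) u (x i) ⟩
        eval (map (- u *_) w) (x i) + u * x i ^ m       ≈⟨ +-cong (eval-map-* (- u) w (x i)) (*-congˡ (xᵐ≈cf+g i)) ⟩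
        - u * eval w (x i) + u * (c * f i + g i)        ≈⟨ +-congʳ (*-congˡ (g≈w i)) ⟨
        - u * g i + u * (c * f i + g i)                 ≈⟨ collect-leading (- u) u c (f i) (g i) ⟩
        (u * c) * f i + (- u + u) * g i                 ≈⟨ +-cong (*-congʳ (trans (*-comm u c) cu≈1))
                                                                  (trans (*-congʳ (-‿inverseˡ u)) (zeroˡ (g i))) ⟩
        1# * f i + 0#                                   ≈⟨ trans (+-identityʳ _) (*-identityˡ (f i)) ⟩
        f i                                             ∎

    reduce-degree : ∀ {m f} → IsPolyOfDegree m f → (w : Vec Carrier (suc m)) →
                    ∃₂ λ s (w′ : Vec Carrier m) → ∀ i → eval w (x i) ≈ eval w′ (x i) + s * f i
    reduce-degree {m} {f} (v , last≉0 , f≈v) w with initLast v | initLast w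
    ... | vs , k , ≡.refl | ws , l , ≡.refl with inverse k last≉0
    ... | u , ku≈1 = s , zipWith _+_ ws (map (- s *_) vs) , eval≈
      where
      s = l * u
      sk≈l : s * k ≈ l
      sk≈l = trans (*-assoc l u k) (trans (*-congˡ (trans (*-comm u k) ku≈1)) (*-identityʳ l))
      eval≈ : ∀ i → eval (ws ∷ʳ l) (x i) ≈ eval (zipWith _+_ ws (map (- s *_) vs)) (x i) + s * f i
      eval≈ i = let t = x i in sym (begin
        eval (zipWith _+_ ws (map (- s *_) vs)) t + s * f i
          ≈⟨ +-cong (trans (eval-zipWith-+ ws _ t) (+-congˡ (eval-map-* (- s) vs t)))
                    (*-congˡ (trans (f≈v i) (eval-∷ʳ vs k t))) ⟩
        (eval ws t + - s * eval vs t) + s * (eval vs t + k * t ^ m)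
          ≈⟨ collect-elimination (eval ws t) (eval vs t) (- s) s k (t ^ m) ⟩
        (eval ws t + (- s + s) * eval vs t) + (s * k) * t ^ m
          ≈⟨ +-cong (trans (+-congˡ (trans (*-congʳ (-‿inverseˡ s)) (zeroˡ _))) (+-identityʳ _))
                    (*-congʳ sk≈l) ⟩
        eval ws t + l * t ^ m
          ≈⟨ eval-∷ʳ ws l t ⟨
        eval (ws ∷ʳ l) t ∎)

    annihilate-poly< : ∀ (e : Fin N → Carrier) m →
      (∀ k → k < m → ∃ λ g → IsPolyOfDegree k g × Σ[ N ] (λ i → g i * e i) ≈ 0#) →
      ∀ {f} → IsPoly< m f → Σ[ N ] (λ i → f i * e i) ≈ 0#
    annihilate-poly< e zero    basis ([] , f≈0) = Σ-≈0 (λ i → trans (*-congʳ (f≈0 i)) (zeroˡ (e i)))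
    annihilate-poly< e (suc m) basis {f} (w , f≈w) with basis m ℕ.≤-refl
    ... | g , g-deg , g⊥e with reduce-degree g-deg w
    ... | s , w′ , w≈w′+sg = begin
      Σ[ N ] (λ i → f i * e i)
        ≈⟨ Σ-cong (λ i → trans (*-congʳ (trans (f≈w i) (w≈w′+sg i))) (distribʳ (e i) _ _)) ⟩
      Σ[ N ] (λ i → eval w′ (x i) * e i + (s * g i) * e i)
        ≈⟨ Σ-distrib-+ (λ i → eval w′ (x i) * e i) (λ i → (s * g i) * e i) ⟩
      Σ[ N ] (λ i → eval w′ (x i) * e i) + Σ[ N ] (λ i → (s * g i) * e i)
        ≈⟨ +-cong (annihilate-poly< e m (λ k k<m → basis k (ℕ.m≤n⇒m≤1+n k<m)) (w′ , λ _ → refl))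
                  (trans (Σ-cong (λ i → *-assoc s (g i) (e i))) (sym (*-distribˡ-Σ s (λ i → g i * e i)))) ⟩
      0# + s * Σ[ N ] (λ i → g i * e i)
        ≈⟨ trans (+-identityˡ _) (trans (*-congˡ g⊥e) (zeroʳ s)) ⟩
      0# ∎

module Spectral {c ℓ : Level} (K : CharZeroField c ℓ) {n d : ℕ}
                (S : SymAssocScheme n d) (Ei : Scheme.Eigen K S) where
  open FieldProperties K
  open Matrices K hiding (Σ[_]; eval)
  open Scheme K S
  open SymAssocScheme S
  open Eigen Ei

  Spec : (Fin (suc d) → Carrier) → Mat n
  Spec f = Σₘ[ suc d ] (λ j → f j • E j)

  ·-congˡ : ∀ {M M′} (N : Mat n) → M ≈ₘ M′ → (M · N) ≈ₘ (M′ · N)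
  ·-congˡ N M≈M′ x y = Σ-cong (λ z → *-congʳ (M≈M′ x z))

  ·-congʳ : ∀ (M : Mat n) {N N′} → N ≈ₘ N′ → (M · N) ≈ₘ (M · N′)
  ·-congʳ M N≈N′ x y = Σ-cong (λ z → *-congˡ (N≈N′ z y))

  E-orthogonal : ∀ {j k} → j ≢ k → ∀ x y → (E j · E k) x y ≈ 0#
  E-orthogonal {j} {k} j≢k x y = trans (E-orth j k x y)
    (reflexive (≡.cong (λ b → (if b then E j else 𝟎) x y) (dec-false (j ≟ k) j≢k)))

  E-idempotent : ∀ k x y → (E k · E k) x y ≈ E k x y
  E-idempotent k x y = trans (E-orth k k x y)
    (reflexive (≡.cong (λ b → (if b then E k else 𝟎) x y) (dec-true (k ≟ k) ≡.refl)))

  ·-Spec : ∀ (M : Mat n) g x y → (M · Spec g) x y ≈ Σ[ suc d ] (λ k → g k * (M · E k) x y)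
  ·-Spec M g x y = begin
    Σ[ n ] (λ z → M x z * Σ[ suc d ] (λ k → g k * E k z y))
      ≈⟨ Σ-cong (λ z → *-distribˡ-Σ (M x z) (λ k → g k * E k z y)) ⟩
    Σ[ n ] (λ z → Σ[ suc d ] (λ k → M x z * (g k * E k z y)))
      ≈⟨ Σ-comm (λ z k → M x z * (g k * E k z y)) ⟩
    Σ[ suc d ] (λ k → Σ[ n ] (λ z → M x z * (g k * E k z y)))
      ≈⟨ Σ-cong (λ k → Σ-cong (λ z → x∙yz≈y∙xz (M x z) (g k) (E k z y))) ⟩
    Σ[ suc d ] (λ k → Σ[ n ] (λ z → g k * (M x z * E k z y)))
      ≈⟨ Σ-cong (λ k → *-distribˡ-Σ (g k) (λ z → M x z * E k z y)) ⟨
    Σ[ suc d ] (λ k → g k * (M · E k) x y) ∎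

  Spec-· : ∀ f (M : Mat n) x y → (Spec f · M) x y ≈ Σ[ suc d ] (λ j → f j * (E j · M) x y)
  Spec-· f M x y = begin
    Σ[ n ] (λ z → Σ[ suc d ] (λ j → f j * E j x z) * M z y)
      ≈⟨ Σ-cong (λ z → *-distribʳ-Σ (M z y) (λ j → f j * E j x z)) ⟩
    Σ[ n ] (λ z → Σ[ suc d ] (λ j → (f j * E j x z) * M z y))
      ≈⟨ Σ-comm (λ z j → (f j * E j x z) * M z y) ⟩
    Σ[ suc d ] (λ j → Σ[ n ] (λ z → (f j * E j x z) * M z y))
      ≈⟨ Σ-cong (λ j → Σ-cong (λ z → *-assoc (f j) (E j x z) (M z y))) ⟩
    Σ[ suc d ] (λ j → Σ[ n ] (λ z → f j * (E j x z * M z y)))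
      ≈⟨ Σ-cong (λ j → *-distribˡ-Σ (f j) (λ z → E j x z * M z y)) ⟨
    Σ[ suc d ] (λ j → f j * (E j · M) x y) ∎

  E-·-Spec : ∀ j g → (E j · Spec g) ≈ₘ (g j • E j)
  E-·-Spec j g x y = begin
    (E j · Spec g) x y                             ≈⟨ ·-Spec (E j) g x y ⟩
    Σ[ suc d ] (λ k → g k * (E j · E k) x y)       ≈⟨ Σ-single (λ k → g k * (E j · E k) x y) j (λ k k≢j →
                                                        trans (*-congˡ (E-orthogonal (k≢j ∘ ≡.sym) x y)) (zeroʳ (g k))) ⟩
    g j * (E j · E j) x y                          ≈⟨ *-congˡ (E-idempotent j x y) ⟩
    g j * E j x y                                  ∎

  Spec-·-E : ∀ f k → (Spec f · E k) ≈ₘ (f k • E k)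
  Spec-·-E f k x y = begin
    (Spec f · E k) x y                             ≈⟨ Spec-· f (E k) x y ⟩
    Σ[ suc d ] (λ j → f j * (E j · E k) x y)       ≈⟨ Σ-single (λ j → f j * (E j · E k) x y) k (λ j j≢k →
                                                        trans (*-congˡ (E-orthogonal j≢k x y)) (zeroʳ (f j))) ⟩
    f k * (E k · E k) x y                          ≈⟨ *-congˡ (E-idempotent k x y) ⟩
    f k * E k x y                                  ∎

  Spec-·-Spec : ∀ f g → (Spec f · Spec g) ≈ₘ Spec (λ j → f j * g j)
  Spec-·-Spec f g x y = begin
    (Spec f · Spec g) x y                          ≈⟨ ·-Spec (Spec f) g x y ⟩
    Σ[ suc d ] (λ k → g k * (Spec f · E k) x y)    ≈⟨ Σ-cong (λ k → *-congˡ {g k} (Spec-·-E f k x y)) ⟩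
    Σ[ suc d ] (λ k → g k * (f k * E k x y))       ≈⟨ Σ-cong {g = λ k → (f k * g k) * E k x y} (λ k → x∙yz≈yx∙z (g k) (f k) (E k x y)) ⟩
    Spec (λ j → f j * g j) x y                     ∎

  𝐈≈Spec-1 : 𝐈 ≈ₘ Spec (λ _ → 1#)
  𝐈≈Spec-1 x y = sym (trans (Σ-cong (λ j → *-identityˡ (E j x y))) (E-sum x y))

  A-≢ : ∀ {i x y} → rel x y ≢ i → A i x y ≡ 0#
  A-≢ {i} {x} {y} r≢i = ≡.cong (λ b → if b then 1# else 0#) (dec-false (rel x y ≟ i) r≢i)

  A-≡ : ∀ {i x y} → rel x y ≡ i → A i x y ≡ 1#
  A-≡ {i} {x} {y} r≡i = ≡.cong (λ b → if b then 1# else 0#) (dec-true (rel x y ≟ i) r≡i)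

  Σ-A : ∀ (a : Fin (suc d) → Carrier) x y → Σ[ suc d ] (λ i → a i * A i x y) ≈ a (rel x y)
  Σ-A a x y = begin
    Σ[ suc d ] (λ i → a i * A i x y)   ≈⟨ Σ-single (λ i → a i * A i x y) (rel x y) (λ i i≢r →
                                            trans (*-congˡ (reflexive (A-≢ (i≢r ∘ ≡.sym)))) (zeroʳ (a i))) ⟩
    a (rel x y) * A (rel x y) x y      ≈⟨ *-congˡ (reflexive (A-≡ ≡.refl)) ⟩
    a (rel x y) * 1#                   ≈⟨ *-identityʳ _ ⟩
    a (rel x y)                        ∎

  Σ-A≈Spec : ∀ (a : Fin (suc d) → Carrier) x y →
             Σ[ suc d ] (λ i → a i * A i x y) ≈ Spec (λ j → Σ[ suc d ] (λ i → a i * P i j)) x y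
  Σ-A≈Spec a x y = begin
    Σ[ suc d ] (λ i → a i * A i x y)
      ≈⟨ Σ-cong (λ i → trans (*-congˡ (A-P i x y)) (*-distribˡ-Σ (a i) (λ j → P i j * E j x y))) ⟩
    Σ[ suc d ] (λ i → Σ[ suc d ] (λ j → a i * (P i j * E j x y)))
      ≈⟨ Σ-comm (λ i j → a i * (P i j * E j x y)) ⟩
    Σ[ suc d ] (λ j → Σ[ suc d ] (λ i → a i * (P i j * E j x y)))
      ≈⟨ Σ-cong (λ j → trans (Σ-cong (λ i → sym (*-assoc (a i) (P i j) (E j x y))))
                             (sym (*-distribʳ-Σ (E j x y) (λ i → a i * P i j)))) ⟩
    Spec (λ j → Σ[ suc d ] (λ i → a i * P i j)) x y ∎

  γ : Fin (suc d) → Fin (suc d) → Carrier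
  γ j = proj₁ (E-in-BM j)

  E-entry : ∀ j x y → E j x y ≈ γ j (rel x y)
  E-entry j x y = trans (proj₂ (E-in-BM j) x y) (Σ-A (γ j) x y)

  coeff : (Fin (suc d) → Carrier) → Fin (suc d) → Carrier
  coeff f r = Σ[ suc d ] (λ j → f j * γ j r)

  Spec-entry : ∀ f x y → Spec f x y ≈ coeff f (rel x y)
  Spec-entry f x y = Σ-cong {g = λ j → f j * γ j (rel x y)} (λ j → *-congˡ (E-entry j x y))

  E·A-diagonal : ∀ j i x → (E j · A i) x x ≈ γ j i * Σ[ n ] (A i x)
  E·A-diagonal j i x = begin
    Σ[ n ] (λ y → E j x y * A i y x)    ≈⟨ Σ-cong entry ⟩
    Σ[ n ] (λ y → γ j i * A i x y)      ≈⟨ *-distribˡ-Σ (γ j i) (A i x) ⟨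
    γ j i * Σ[ n ] (A i x)              ∎
    where
    entry : ∀ y → E j x y * A i y x ≈ γ j i * A i x y
    entry y with rel x y ≟ i
    ... | yes r≡i = begin
      E j x y * A i y x   ≈⟨ *-cong (E-entry j x y) (reflexive (A-≡ (≡.trans (rel-symm y x) r≡i))) ⟩
      γ j (rel x y) * 1#  ≡⟨ ≡.cong (λ r → γ j r * 1#) r≡i ⟩
      γ j i * 1#          ∎
    ... | no r≢i = trans (*-congˡ (reflexive (A-≢ (r≢i ∘ ≡.trans (rel-symm x y))))) (trans (zeroʳ _) (sym (zeroʳ _)))

  row-sum≉0 : ∀ {i x y} → rel x y ≡ i → Σ[ n ] (A i x) ≉ 0#
  row-sum≉0 {i} {x} {y} r≡i row≈0 = ι≉0 valency≢0 (trans ι-valency row≈0)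
    where
    indicator : Fin n → ℕ
    indicator z = if rel x z == i then 1 else 0
    ι-indicator : ∀ z → ι (indicator z) ≈ A i x z
    ι-indicator z with rel x z == i
    ... | true  = +-identityʳ 1#
    ... | false = refl
    ι-valency : ι (sumℕ indicator) ≈ Σ[ n ] (A i x)
    ι-valency = trans (ι-sum indicator) (Σ-cong ι-indicator)
    valency≢0 : sumℕ indicator ≢ 0
    valency≢0 valency≡0 = ℕ.1+n≢0 (≡.trans (≡.sym (≡.cong (λ b → if b then 1 else 0) (dec-true (rel x y ≟ i) r≡i)))
                                           (sumℕ≡0⇒≡0 indicator valency≡0 y))

  -- Spec-injective needs an explicit nonzero entry of E j, which E-nonzero does not provide.
  -- The diagonal of E j is the constant γ j 0; were it 0, E j · A i = P i j • E j would force
  -- every γ j i to vanish.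
  E-diagonal≉0 : ∀ j x → E j x x ≉ 0#
  E-diagonal≉0 j x₀ E[x₀,x₀]≈0 = E-nonzero j (λ x y → trans (E-entry j x y) (γ≈0 (rel x y)))
    where
    E-diagonal≈0 : ∀ x → E j x x ≈ 0#
    E-diagonal≈0 x = begin
      E j x x            ≈⟨ E-entry j x x ⟩
      γ j (rel x x)      ≡⟨ ≡.cong (γ j) (≡.trans (rel-diag x) (≡.sym (rel-diag x₀))) ⟩
      γ j (rel x₀ x₀)    ≈⟨ E-entry j x₀ x₀ ⟨
      E j x₀ x₀          ≈⟨ E[x₀,x₀]≈0 ⟩
      0#                 ∎
    γ≈0 : ∀ i → γ j i ≈ 0#
    γ≈0 i with rel-nonempty i
    ... | x , y , r≡i = *-≈0⇒≈0 (row-sum≉0 r≡i) (begin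
      Σ[ n ] (A i x) * γ j i    ≈⟨ *-comm _ (γ j i) ⟩
      γ j i * Σ[ n ] (A i x)    ≈⟨ E·A-diagonal j i x ⟨
      (E j · A i) x x           ≈⟨ ·-congʳ (E j) (A-P i) x x ⟩
      (E j · Spec (P i)) x x    ≈⟨ E-·-Spec j (P i) x x ⟩
      P i j * E j x x           ≈⟨ *-congˡ (E-diagonal≈0 x) ⟩
      P i j * 0#                ≈⟨ zeroʳ (P i j) ⟩
      0#                        ∎)

  Spec-injective : ∀ {f g} → Spec f ≈ₘ Spec g → ∀ j → f j ≈ g j
  Spec-injective {f} {g} Sf≈Sg j with rel-nonempty zero
  ... | x , _ , _ = *-cancelʳ-≉0 (E-diagonal≉0 j x) (begin
    f j * E j x x          ≈⟨ E-·-Spec j f x x ⟨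
    (E j · Spec f) x x     ≈⟨ ·-congʳ (E j) Sf≈Sg x x ⟩
    (E j · Spec g) x x     ≈⟨ E-·-Spec j g x x ⟩
    g j * E j x x          ∎)

  E₀-entry≉0 : ∀ x y → E zero x y ≉ 0#
  E₀-entry≉0 x y E₀≈0 = 1≉0 (trans (sym (E₀-J x y)) (trans (*-congˡ E₀≈0) (zeroʳ _)))

  appears⇔≉0 : ∀ {M : Mat n} {a} → (∀ x y → M x y ≈ a (rel x y)) → ∀ r → Appears M r ⇔ a r ≉ 0#
  appears⇔≉0 {M} {a} M≈a r = mk⇔ appears⇒≉0 ≉0⇒appears
    where
    appears⇒≉0 : Appears M r → a r ≉ 0#
    appears⇒≉0 (α , α≉0 , M∘A≈αA) ar≈0 with rel-nonempty r
    ... | x , y , r≡ = α≉0 (begin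
      α                      ≈⟨ *-identityʳ α ⟨
      α * 1#                 ≡⟨ ≡.cong (α *_) (A-≡ r≡) ⟨
      α * A r x y            ≈⟨ M∘A≈αA x y ⟨
      M x y * A r x y        ≈⟨ *-congʳ (trans (M≈a x y) (reflexive (≡.cong a r≡))) ⟩
      a r * A r x y          ≈⟨ *-congʳ ar≈0 ⟩
      0# * A r x y           ≈⟨ zeroˡ _ ⟩
      0#                     ∎)
    ≉0⇒appears : a r ≉ 0# → Appears M r
    ≉0⇒appears ar≉0 = a r , ar≉0 , entry
      where
      entry : ∀ x y → M x y * A r x y ≈ a r * A r x y
      entry x y with rel x y ≟ r
      ... | yes r≡ = *-congʳ (trans (M≈a x y) (reflexive (≡.cong a r≡)))
      ... | no  _  = trans (zeroʳ _) (sym (zeroʳ _))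

module Walks {n d : ℕ} (S : SymAssocScheme n (suc d)) where
  open SymAssocScheme S

  infixr 5 _∷_ _++_

  data Walk : ℕ → Fin n → Fin n → Set where
    []  : ∀ {x} → Walk 0 x x
    _∷_ : ∀ {h x z y} → rel x z ≡ suc zero → Walk h z y → Walk (suc h) x y

  _++_ : ∀ {a b x z y} → Walk a x z → Walk b z y → Walk (a ℕ.+ b) x y
  []       ++ w′ = w′
  (e ∷ w)  ++ w′ = e ∷ (w ++ w′)

  splitAt : ∀ a {b x y} → Walk (a ℕ.+ b) x y → ∃ λ z → Walk a x z × Walk b z y
  splitAt zero    w       = _ , [] , w
  splitAt (suc a) (e ∷ w) with splitAt a w
  ... | z , w₁ , w₂ = z , e ∷ w₁ , w₂

  walks : ℕ → Fin n → Fin n → ℕ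
  walks zero    x y = if x == y then 1 else 0
  walks (suc h) x y = sumℕ (λ z → if rel x z == suc zero then walks h z y else 0)

  walk⇒walks≢0 : ∀ {h x y} → Walk h x y → walks h x y ≢ 0
  walk⇒walks≢0 {x = x} [] = ℕ.1+n≢0 ∘ ≡.trans (≡.cong (λ b → if b then 1 else 0) (≡.sym (dec-true (x ≟ x) ≡.refl)))
  walk⇒walks≢0 {suc h} {x} {y} (_∷_ {z = z} e w) walks≡0 =
    walk⇒walks≢0 w (≡.trans (≡.cong (λ b → if b then walks h z y else 0) (≡.sym (dec-true (rel x z ≟ suc zero) e)))
                            (sumℕ≡0⇒≡0 _ walks≡0 z))

  walks≢0⇒walk : ∀ h {x y} → walks h x y ≢ 0 → Walk h x y
  walks≢0⇒walk zero {x} {y} walks≢0 with x ≟ y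
  ... | yes ≡.refl = []
  ... | no  _      = contradiction ≡.refl walks≢0
  walks≢0⇒walk (suc h) {x} {y} walks≢0
    with ¬∀⟶∃¬ n (λ z → step z ≡ 0) (λ z → step z ℕ.≟ 0) (walks≢0 ∘ ≡0⇒sumℕ≡0 step)
    where
    step : Fin n → ℕ
    step z = if rel x z == suc zero then walks h z y else 0
  ... | z , step≢0 with rel x z ≟ suc zero
  ...   | yes e = e ∷ walks≢0⇒walk h step≢0
  ...   | no  _ = contradiction ≡.refl step≢0

  tail-of-shortest : ∀ {a b x z y} → Walk a x z → (∀ h → h < a ℕ.+ b → ¬ Walk h x y) →
                     ∀ l → l < b → ¬ Walk l z y
  tail-of-shortest {a} w₁ shortest l l<b w₂ = shortest (a ℕ.+ l) (ℕ.+-monoʳ-< a l<b) (w₁ ++ w₂)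

  walk? : ∀ h x y → Dec (Walk h x y)
  walk? h x y = map′ (walks≢0⇒walk h) walk⇒walks≢0 (¬? (walks h x y ℕ.≟ 0))

module AdjacencyPowers {c ℓ : Level} (K : CharZeroField c ℓ) {n d : ℕ}
                       (S : SymAssocScheme n (suc d)) (Ei : Scheme.Eigen K S) where
  open FieldProperties K
  open Matrices K hiding (Σ[_]; eval) renaming (_^_ to _^ᴹ_)
  open SchemeA1 K S
  open SymAssocScheme S
  open Eigen Ei
  open Spectral K S Ei public
  open Walks S public

  θ : Fin (suc (suc d)) → Carrier
  θ j = P one j

  A₁^≈Spec : ∀ h → (A one ^ᴹ h) ≈ₘ Spec (λ j → θ j ^ h)
  A₁^≈Spec zero    = 𝐈≈Spec-1
  A₁^≈Spec (suc h) x y = begin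
    (A one · (A one ^ᴹ h)) x y                ≈⟨ ·-congʳ (A one) (A₁^≈Spec h) x y ⟩
    (A one · Spec (λ j → θ j ^ h)) x y        ≈⟨ ·-congˡ (Spec (λ j → θ j ^ h)) (A-P one) x y ⟩
    (Spec θ · Spec (λ j → θ j ^ h)) x y       ≈⟨ Spec-·-Spec θ (λ j → θ j ^ h) x y ⟩
    Spec (λ j → θ j ^ suc h) x y              ∎

  powCoeff : ℕ → Fin (suc (suc d)) → Carrier
  powCoeff h = coeff (λ j → θ j ^ h)

  A₁^-entry : ∀ h x y → (A one ^ᴹ h) x y ≈ powCoeff h (rel x y)
  A₁^-entry h x y = trans (A₁^≈Spec h x y) (Spec-entry (λ j → θ j ^ h) x y)

  θ^≈Σ-powCoeff : ∀ h j → θ j ^ h ≈ Σ[ suc (suc d) ] (λ r → powCoeff h r * P r j)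
  θ^≈Σ-powCoeff h = Spec-injective λ x y → begin
    Spec (λ j → θ j ^ h) x y                               ≈⟨ A₁^≈Spec h x y ⟨
    (A one ^ᴹ h) x y                                       ≈⟨ A₁^-entry h x y ⟩
    powCoeff h (rel x y)                                   ≈⟨ Σ-A (powCoeff h) x y ⟨
    Σ[ suc (suc d) ] (λ r → powCoeff h r * A r x y)        ≈⟨ Σ-A≈Spec (powCoeff h) x y ⟩
    Spec (λ j → Σ[ suc (suc d) ] (λ r → powCoeff h r * P r j)) x y ∎

  A₁^≈walks : ∀ h x y → (A one ^ᴹ h) x y ≈ ι (walks h x y)
  A₁^≈walks zero x y with x == y
  ... | true  = sym (+-identityʳ 1#)
  ... | false = refl
  A₁^≈walks (suc h) x y = begin
    Σ[ n ] (λ z → A one x z * (A one ^ᴹ h) z y)   ≈⟨ Σ-cong step ⟩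
    Σ[ n ] (λ z → ι (walks-via z))                 ≈⟨ ι-sum walks-via ⟨
    ι (walks (suc h) x y)                          ∎
    where
    walks-via : Fin n → ℕ
    walks-via z = if rel x z == one then walks h z y else 0
    step : ∀ z → A one x z * (A one ^ᴹ h) z y ≈ ι (walks-via z)
    step z with rel x z == one
    ... | true  = trans (*-identityˡ _) (A₁^≈walks h z y)
    ... | false = zeroˡ _

  ¬walk⇒A₁^≈0 : ∀ {h x y} → ¬ Walk h x y → (A one ^ᴹ h) x y ≈ 0#
  ¬walk⇒A₁^≈0 {h} {x} {y} ¬walk with walks h x y ℕ.≟ 0
  ... | yes walks≡0 = trans (A₁^≈walks h x y) (reflexive (≡.cong ι walks≡0))
  ... | no  walks≢0 = contradiction (walks≢0⇒walk h walks≢0) ¬walk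

  walk⇔powCoeff≉0 : ∀ {h x y r} → rel x y ≡ r → Walk h x y ⇔ powCoeff h r ≉ 0#
  walk⇔powCoeff≉0 {h} {x} {y} ≡.refl = mk⇔ walk⇒≉0 ≉0⇒walk
    where
    walk⇒≉0 : Walk h x y → powCoeff h (rel x y) ≉ 0#
    walk⇒≉0 w c≈0 = ι≉0 (walk⇒walks≢0 w)
      (trans (sym (A₁^≈walks h x y)) (trans (A₁^-entry h x y) c≈0))
    ≉0⇒walk : powCoeff h (rel x y) ≉ 0# → Walk h x y
    ≉0⇒walk c≉0 with walk? h x y
    ... | yes walk = walk
    ... | no ¬walk = contradiction (trans (sym (A₁^-entry h x y)) (¬walk⇒A₁^≈0 ¬walk)) c≉0

  appears⇔powCoeff≉0 : ∀ h r → Appears (A one ^ᴹ h) r ⇔ powCoeff h r ≉ 0#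
  appears⇔powCoeff≉0 h = appears⇔≉0 {a = powCoeff h} (A₁^-entry h)

  walk⇔appears : ∀ {h x y r} → rel x y ≡ r → Walk h x y ⇔ Appears (A one ^ᴹ h) r
  walk⇔appears {h} {r = r} r≡ = ⇔.trans (walk⇔powCoeff≉0 r≡) (⇔.sym (appears⇔powCoeff≉0 h r))

  appears? : ∀ h r → Dec (Appears (A one ^ᴹ h) r)
  appears? h r with rel-nonempty r
  ... | x , y , r≡ = Dec.map (walk⇔appears r≡) (walk? h x y)

  ¬appears⇒powCoeff≈0 : ∀ {h r} → ¬ Appears (A one ^ᴹ h) r → powCoeff h r ≈ 0#
  ¬appears⇒powCoeff≈0 {h} {r} ¬appears with rel-nonempty r
  ... | x , y , ≡.refl = trans (sym (A₁^-entry h x y))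
                               (¬walk⇒A₁^≈0 (¬appears ∘ Equivalence.to (walk⇔appears {h} ≡.refl)))

  appears-at-0 : ∀ {r} → Appears (A one ^ᴹ 0) r → r ≡ zero
  appears-at-0 {r} appears with rel-nonempty r
  ... | x , y , r≡ with Equivalence.from (walk⇔appears {0} r≡) appears
  ...   | [] = ≡.trans (≡.sym r≡) (rel-diag x)

  appears-at-1 : ∀ {r} → Appears (A one ^ᴹ 1) r → r ≡ one
  appears-at-1 {r} appears with rel-nonempty r
  ... | x , y , r≡ with Equivalence.from (walk⇔appears {1} r≡) appears
  ...   | e ∷ [] = ≡.trans (≡.sym r≡) e

  InNstar? : ∀ h r → Dec (InNstar h r)
  InNstar? h r = appears? h r ×-dec map′ explicit implicit (ℕ.allUpTo? (λ l → ¬? (appears? l r)) h)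
    where
    explicit : (∀ {l} → l < h → ¬ Appears (A one ^ᴹ l) r) → ∀ l → l < h → ¬ Appears (A one ^ᴹ l) r
    explicit absent l = absent
    implicit : (∀ l → l < h → ¬ Appears (A one ^ᴹ l) r) → ∀ {l} → l < h → ¬ Appears (A one ^ᴹ l) r
    implicit absent {l} = absent l

  first-appearance-≤ : ∀ {h h′ r} → InNstar h r → Appears (A one ^ᴹ h′) r → h ≤ h′
  first-appearance-≤ (_ , absent) appears = ℕ.≮⇒≥ (λ h′<h → absent _ h′<h appears)

  first-appearance-unique : ∀ {h h′ r} → InNstar h r → InNstar h′ r → h ≡ h′
  first-appearance-unique first first′ =
    ℕ.≤-antisym (first-appearance-≤ first (proj₁ first′)) (first-appearance-≤ first′ (proj₁ first))

  absent-below : ∀ {r} b → (∀ h → h < b → ¬ InNstar h r) → ∀ h → h < b → ¬ Appears (A one ^ᴹ h) r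
  absent-below (suc b) not-first h h<b+1 appears with ℕ.m<1+n⇒m<n∨m≡n h<b+1
  ... | inj₁ h<b    = absent-below b (λ l → not-first l ∘ ℕ.m≤n⇒m≤1+n) h h<b appears
  ... | inj₂ ≡.refl = not-first h h<b+1 (appears , absent-below h (λ l → not-first l ∘ ℕ.m≤n⇒m≤1+n))

module PPolynomial⇒Cond2 {c ℓ : Level} (K : CharZeroField c ℓ) {n d : ℕ}
                         (S : SymAssocScheme n (suc d)) (Ei : Scheme.Eigen K S) where
  open FieldProperties K
  open Matrices K hiding (Σ[_]; eval) renaming (_^_ to _^ᴹ_)
  open SchemeA1 K S
  open SymAssocScheme S
  open Eigen Ei
  open AdjacencyPowers K S Ei
  open Polynomials K
  open PolynomialsOn θ

  module _ (ξ : Fin (suc (suc d)) → Fin (suc (suc d))) (ξ-injective : Injective _≡_ _≡_ ξ)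
           (v : (i : Fin (suc (suc d))) → Vec Carrier (suc (toℕ i)))
           (v-leading : ∀ i → last (v i) ≉ 0#) (P∘ξ≈v : ∀ i j → P (ξ i) j ≈ eval (v i) (θ j)) where

    P∘ξ-degree : ∀ {k} (k<D+1 : k < suc (suc d)) → IsPolyOfDegree k (P (ξ (fromℕ< k<D+1)))
    P∘ξ-degree k<D+1 = ≡.subst (λ m → IsPolyOfDegree m (P (ξ i))) (toℕ-fromℕ< k<D+1) (v i , v-leading i , P∘ξ≈v i)
      where i = fromℕ< k<D+1

    -- Below degree D the powers of A₁ lie in the span of A_{ξ 0}, …, A_{ξ (D-1)}.
    A₁^-vanishes-off-span : ∀ {h x y} → h < suc d → rel x y ≡ ξ (Fin.fromℕ (suc d)) → (A one ^ᴹ h) x y ≈ 0#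
    A₁^-vanishes-off-span {h} {x} {y} h<D r≡top = begin
      (A one ^ᴹ h) x y                   ≈⟨ A₁^≈Spec h x y ⟩
      Spec (λ j → θ j ^ h) x y           ≈⟨ annihilate-poly< (λ j → E j x y) (suc h) basis (degree⇒poly< (monomial h)) ⟩
      0#                                 ∎
      where
      basis : ∀ k → k < suc h → ∃ λ g → IsPolyOfDegree k g × Spec g x y ≈ 0#
      basis k k<h+1 = P (ξ i) , P∘ξ-degree k<D+1 , (begin
        Spec (P (ξ i)) x y     ≈⟨ A-P (ξ i) x y ⟨
        A (ξ i) x y            ≡⟨ A-≢ (λ r≡ξi → ℕ.<-irrefl (≡.sym (toℕ-top≡k r≡ξi)) k<D) ⟩
        0#                     ∎)
        where
        k<D : k < suc d
        k<D = ℕ.≤-trans k<h+1 h<D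
        k<D+1 = ℕ.m≤n⇒m≤1+n k<D
        i = fromℕ< k<D+1
        toℕ-top≡k : rel x y ≡ ξ i → suc d ≡ k
        toℕ-top≡k r≡ξi = ≡.trans (≡.sym (toℕ-fromℕ (suc d)))
          (≡.trans (≡.cong toℕ (ξ-injective (≡.trans (≡.sym r≡top) r≡ξi))) (toℕ-fromℕ< k<D+1))

    never-appears-before-D : ∀ h → h < suc d → ¬ Appears (A one ^ᴹ h) (ξ (Fin.fromℕ (suc d)))
    never-appears-before-D h h<D appears with rel-nonempty (ξ (Fin.fromℕ (suc d)))
    ... | x , y , r≡top = Equivalence.to (appears⇔powCoeff≉0 h _) appears (begin
      powCoeff h (ξ (Fin.fromℕ (suc d)))   ≡⟨ ≡.cong (powCoeff h) r≡top ⟨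
      powCoeff h (rel x y)                 ≈⟨ A₁^-entry h x y ⟨
      (A one ^ᴹ h) x y                     ≈⟨ A₁^-vanishes-off-span h<D r≡top ⟩
      0#                                   ∎)

  ppolynomial⇒cond2 : PPolynomial Ei → Cond2
  ppolynomial⇒cond2 (ξ , (ξ-injective , _) , _ , _ , v , v-leading , P∘ξ≈v) all-reached
    with all-reached (ξ (Fin.fromℕ (suc d)))
  ... | h , h<D , appears , _ = never-appears-before-D ξ ξ-injective v v-leading P∘ξ≈v h h<D appears

module Cond2⇒PPolynomial {c ℓ : Level} (K : CharZeroField c ℓ) {n d : ℕ}
                         (S : SymAssocScheme n (suc d)) (Ei : Scheme.Eigen K S) where
  open FieldProperties K
  open Matrices K hiding (Σ[_]; eval) renaming (_^_ to _^ᴹ_)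
  open SchemeA1 K S
  open SymAssocScheme S
  open Eigen Ei
  open AdjacencyPowers K S Ei
  open Polynomials K
  open PolynomialsOn θ

  -- η k is the relation between y* and the vertex of the geodesic at distance k from y*.
  module Geodesic {x* y* : Fin n} (geodesic : Walk (suc d) x* y*)
                  (shortest : ∀ h → h < suc d → ¬ Walk h x* y*) where

    split : (k : Fin (suc (suc d))) → ∃ λ z → Walk (suc d ∸ toℕ k) x* z × Walk (toℕ k) z y*
    split k = splitAt (suc d ∸ toℕ k) (≡.subst (λ m → Walk m x* y*) (≡.sym D-k+k≡D) geodesic)
      where D-k+k≡D = ℕ.m∸n+n≡m (toℕ≤pred[n] k)

    η : Fin (suc (suc d)) → Fin (suc (suc d))
    η k = rel (proj₁ (split k)) y*

    η-first : ∀ k → InNstar (toℕ k) (η k)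
    η-first k = Equivalence.to (walk⇔appears ≡.refl) (proj₂ (proj₂ (split k))) , absent
      where
      shortest′ : ∀ h → h < (suc d ∸ toℕ k) ℕ.+ toℕ k → ¬ Walk h x* y*
      shortest′ h h< = shortest h (≡.subst (h <_) (ℕ.m∸n+n≡m (toℕ≤pred[n] k)) h<)
      absent : ∀ l → l < toℕ k → ¬ Appears (A one ^ᴹ l) (η k)
      absent l l<k = tail-of-shortest (proj₁ (proj₂ (split k))) shortest′ l l<k
                   ∘ Equivalence.from (walk⇔appears ≡.refl)

    η-injective : Injective _≡_ _≡_ η
    η-injective {a} {b} ηa≡ηb = toℕ-injective
      (first-appearance-unique (η-first a) (≡.subst (InNstar (toℕ b)) (≡.sym ηa≡ηb) (η-first b)))

    η-surjective : Surjective _≡_ _≡_ η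
    η-surjective = injective⇒surjective η-injective

    P∘η-degree : ∀ i → IsPolyOfDegree (toℕ i) (P (η i))
    P∘η-degree = All.wfRec <-wellFounded (c ⊔ ℓ) (λ i → IsPolyOfDegree (toℕ i) (P (η i))) step
      where
      step : ∀ i → (∀ {k} → k Fin.< i → IsPolyOfDegree (toℕ k) (P (η k))) → IsPolyOfDegree (toℕ i) (P (η i))
      step i IH = poly-of-degree {f = P (η i)} {g = lower}
                                 (Equivalence.to (appears⇔powCoeff≉0 h (η i)) (proj₁ (η-first i)))
                                 (poly<-Σ {F = λ k j → powCoeff h (punchIn (η i) k) * P (punchIn (η i) k) j}
                                          (λ k → lower-term (punchIn (η i) k) (punchInᵢ≢i (η i) k)))
                                 expansion
        where
        h = toℕ i
        lower : Fin (suc (suc d)) → Carrier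
        lower j = Σ[ suc d ] (λ k → powCoeff h (punchIn (η i) k) * P (punchIn (η i) k) j)
        expansion : ∀ j → θ j ^ h ≈ powCoeff h (η i) * P (η i) j + lower j
        expansion j = trans (θ^≈Σ-powCoeff h j) (Σ-remove (λ r → powCoeff h r * P r j) (η i))
        lower-term : ∀ r → r ≢ η i → IsPoly< h (λ j → powCoeff h r * P r j)
        lower-term r r≢ηi with appears? h r
        ... | no ¬appears = poly<-resp (λ j → sym (trans (*-congʳ (¬appears⇒powCoeff≈0 {h} ¬appears)) (zeroˡ _)))
                                       poly<-zero
        ... | yes appears = poly<-scale (powCoeff h r)
                              (poly<-resp (λ j → reflexive (≡.cong (λ s → P s j) ηk≡r))
                                          (poly<-mono k<h (degree⇒poly< (IH k<h))))
          where
          k = proj₁ (η-surjective r)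
          ηk≡r : η k ≡ r
          ηk≡r = proj₂ (η-surjective r) ≡.refl
          k≤h : toℕ k ≤ h
          k≤h = first-appearance-≤ (≡.subst (InNstar (toℕ k)) ηk≡r (η-first k)) appears
          k<h : toℕ k < h
          k<h = ℕ.≤∧≢⇒< k≤h (λ k≡h → r≢ηi (≡.trans (≡.sym ηk≡r) (≡.cong η (toℕ-injective k≡h))))

    ppolynomial : PPolynomial Ei
    ppolynomial = η , (η-injective , η-surjective)
                , appears-at-0 (proj₁ (η-first zero)) , appears-at-1 (proj₁ (η-first one))
                , (λ i → proj₁ (P∘η-degree i)) , (λ i → proj₁ (proj₂ (P∘η-degree i)))
                , (λ i → proj₂ (proj₂ (P∘η-degree i)))

  module _ (θ₀-simple : ∀ j → j ≢ zero → θ zero ≉ θ j) where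

    -- ∏_{k ≥ 1} (A₁ − θ_k I) = ∏_{k ≥ 1} (θ₀ − θ_k) • E₀ has no zero entry, yet it is a
    -- polynomial of degree at most D in A₁.
    walk-within-diameter : ∀ x y → ∃ λ h → h < suc (suc d) × Walk h x y
    walk-within-diameter x y with ℕ.anyUpTo? (λ h → walk? h x y) (suc (suc d))
    ... | yes found = found
    ... | no  none  = contradiction (*-≈0⇒≈0 f₀≉0 (trans (sym Spec-f≈f₀E₀) Spec-f≈0)) (E₀-entry≉0 x y)
      where
      f : Fin (suc (suc d)) → Carrier
      f j = ∏ (λ k → θ j - θ (suc k))
      f₀≉0 : f zero ≉ 0#
      f₀≉0 = ∏-≉0 (λ k → θ zero - θ (suc k)) (λ k θ₀-θ≈0 → θ₀-simple (suc k) (λ ()) (x∙y⁻¹≈ε⇒x≈y _ _ θ₀-θ≈0))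
      Spec-f≈f₀E₀ : Spec f x y ≈ f zero * E zero x y
      Spec-f≈f₀E₀ = Σ-single (λ j → f j * E j x y) zero vanish
        where
        vanish : ∀ j → j ≢ zero → f j * E j x y ≈ 0#
        vanish zero    0≢0 = contradiction ≡.refl 0≢0
        vanish (suc k) _   = trans (*-congʳ (∏-≈0 (λ q → θ (suc k) - θ (suc q)) k (-‿inverseʳ (θ (suc k))))) (zeroˡ _)
      monomials-vanish : ∀ k → k < suc (suc d) → ∃ λ g → IsPolyOfDegree k g × Spec g x y ≈ 0#
      monomials-vanish k k<D+1 = (λ j → θ j ^ k) , monomial k ,
        trans (sym (A₁^≈Spec k x y)) (¬walk⇒A₁^≈0 (λ walk → none (k , k<D+1 , walk)))
      Spec-f≈0 : Spec f x y ≈ 0#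
      Spec-f≈0 = annihilate-poly< (λ j → E j x y) (suc (suc d)) monomials-vanish (poly<-∏-linear (θ ∘ suc))

    cond2⇒ppolynomial : Cond2 → PPolynomial Ei
    cond2⇒ppolynomial cond2
      with ¬∀⟶∃¬ (suc (suc d)) _ (λ r → ℕ.anyUpTo? (λ h → InNstar? h r) (suc d)) cond2
    ... | r , no-first-appearance with rel-nonempty r
    ... | x , y , r≡ = from-short-walk (walk-within-diameter x y)
      where
      shortest : ∀ h → h < suc d → ¬ Walk h x y
      shortest h h<D = absent-below (suc d) (λ l l<D first → no-first-appearance (l , l<D , first)) h h<D
                     ∘ Equivalence.to (walk⇔appears r≡)
      from-short-walk : (∃ λ h → h < suc (suc d) × Walk h x y) → PPolynomial Ei
      from-short-walk (h , h≤D , walk) with ℕ.m<1+n⇒m<n∨m≡n h≤D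
      ... | inj₁ h<D    = contradiction walk (shortest h h<D)
      ... | inj₂ ≡.refl = Geodesic.ppolynomial walk shortest

lemma3p2 : ∀ {c ℓ : Level} (K : CharZeroField c ℓ) {n d : ℕ}
    (S : SymAssocScheme n (suc d)) (Ei : Scheme.Eigen K S) →
    (∀ (j : Fin (suc (suc d))) → j ≢ zero →
      ¬ CharZeroField._≈_ K (Scheme.Eigen.P Ei (SchemeA1.one K S) zero)
                            (Scheme.Eigen.P Ei (SchemeA1.one K S) j)) →
    SchemeA1.PPolynomial K S Ei ⇔ SchemeA1.Cond2 K S
lemma3p2 K S Ei θ₀-simple =
  mk⇔ (PPolynomial⇒Cond2.ppolynomial⇒cond2 K S Ei) (Cond2⇒PPolynomial.cond2⇒ppolynomial K S Ei θ₀-simple)
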